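{- Let $\mathcal{Q}_1,\mathcal{Q}_2,\mathcal{Q}_3$ be seminormal quasi-crystals of the same type, with underlying sets $Q_1,Q_2,Q_3$. Then the map $(Q_1\ddot{\otimes}Q_2)\ddot{\otimes}Q_3\to Q_1\ddot{\otimes}(Q_2\ddot{\otimes}Q_3)$, $(x_1\ddot{\otimes}x_2)\ddot{\otimes}x_3\mapsto x_1\ddot{\otimes}(x_2\ddot{\otimes}x_3)$, is a quasi-crystal isomorphism between $(\mathcal{Q}_1\ddot{\otimes}\mathcal{Q}_2)\ddot{\otimes}\mathcal{Q}_3$ and $\mathcal{Q}_1\ddot{\otimes}(\mathcal{Q}_2\ddot{\otimes}\mathcal{Q}_3)$.
   Context: Root system data: $V$ a finite-dimensional real inner product space, $\alpha^\vee=\frac{2}{\langle\alpha,\alpha\rangle}\alpha$; a root system $\Phi\subseteq V\setminus\{0\}$ (nonempty, finite, closed under the reflections $\beta\mapsto\beta-\langle\beta,\alpha^\vee\rangle\alpha$, with $\langle\beta,\alpha^\vee\rangle\in\mathbb{Z}$, and $\alpha,k\alpha\in\Phi\Rightarrow k=\pm1$), fixed simple roots $(\alpha_i)_{i\in I}$ and weight lattice $\Lambda$ (a $\mathbb{Z}$-submodule spanning $V$, containing $\Phi$, with $\langle\lambda,\alpha^\vee\rangle\in\mathbb{Z}$). A quasi-crystal of type $\Phi$ is a set $Q$ with maps $\mathrm{wt}:Q\to\Lambda$, $\ddot{e}_i,\ddot{f}_i:Q\to Q\sqcup\{\bot\}$ ($\bot$ = undefined), $\ddot{\varepsilon}_i,\ddot{\varphi}_i:Q\to\mathbb{Z}\cup\{\pm\infty\}$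 ($i\in I$) such that: $\ddot{\varphi}_i(x)=\ddot{\varepsilon}_i(x)+\langle\mathrm{wt}(x),\alpha_i^\vee\rangle$ (with $m+(\pm\infty)=\pm\infty$); if $\ddot{e}_i(x)\in Q$ then its weight is $\mathrm{wt}(x)+\alpha_i$, its $\ddot{\varepsilon}_i$ is $\ddot{\varepsilon}_i(x)-1$ and its $\ddot{\varphi}_i$ is $\ddot{\varphi}_i(x)+1$; if $\ddot{f}_i(x)\in Q$ then its weight is $\mathrm{wt}(x)-\alpha_i$, $\ddot{\varepsilon}_i$ is $+1$, $\ddot{\varphi}_i$ is $-1$; $\ddot{e}_i(x)=y\iff x=\ddot{f}_i(y)$; and $\ddot{\varepsilon}_i(x)=\pm\infty$ implies $\ddot{e}_i(x)=\ddot{f}_i(x)=\bot$. It is seminormal if whenever $\ddot{\varepsilon}_i(x)\neq+\infty$, $\ddot{\varepsilon}_i(x)=\max\{k\ge0:\ddot{e}_i^k(x)\in Q\}$ and $\ddot{\varphi}_i(x)=\max\{k\ge0:\ddot{f}_i^k(x)\in Q\}$. A quasi-crystal homomorphism $\psi:\mathcal{Q}\to\mathcal{Q}'$ is a map $\psi:Q\sqcup\{\bot\}\to Q'\sqcup\{\bot\}$ with $\psi(\bot)=\bot$ such that for $x\in Q$ with $\psi(x)\in Q'$, $\psi(x)$ has the same $\mathrm{wt},\ddot{\varepsilon}_i,\ddot{\varphi}_i$ as $x$, and if $\ddot{e}_i(x)\in Q$ and $\psi(x),\psi(\ddot{e}_i(x))\in Q'$ then $\psi(\ddot{e}_i(x))=\ddot{e}_i(\psi(x))$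 (same for $\ddot{f}_i$). A map $Q\to Q'$ is regarded as such a map with $\bot\mapsto\bot$. A quasi-crystal isomorphism is a bijection $\psi$ such that $\psi$ and $\psi^{ -1}$ are homomorphisms. Quasi-tensor product: for seminormal $\mathcal{Q},\mathcal{Q}'$ of the same type, $\mathcal{Q}\ddot{\otimes}\mathcal{Q}'$ has underlying set $Q\times Q'$ (elements $x\ddot{\otimes}x'$), $\mathrm{wt}(x\ddot{\otimes}x')=\mathrm{wt}(x)+\mathrm{wt}(x')$, and for $i\in I$: if $\ddot{\varphi}_i(x)>0$ and $\ddot{\varepsilon}_i(x')>0$ then $\ddot{e}_i,\ddot{f}_i$ are undefined on $x\ddot{\otimes}x'$ and $\ddot{\varepsilon}_i=\ddot{\varphi}_i=+\infty$ there; otherwise $\ddot{e}_i(x\ddot{\otimes}x')$ is $\ddot{e}_i(x)\ddot{\otimes}x'$ if $\ddot{\varphi}_i(x)\ge\ddot{\varepsilon}_i(x')$ and $x\ddot{\otimes}\ddot{e}_i(x')$ otherwise, $\ddot{f}_i(x\ddot{\otimes}x')$ is $\ddot{f}_i(x)\ddot{\otimes}x'$ if $\ddot{\varphi}_i(x)>\ddot{\varepsilon}_i(x')$ and $x\ddot{\otimes}\ddot{f}_i(x')$ otherwise (with $x\ddot{\otimes}\bot=\bot\ddot{\otimes}x'=\bot$), $\ddot{\varepsilon}_i(x\ddot{\otimes}x')=\max\{\ddot{\varepsilon}_i(x),\ddot{\varepsilon}_i(x')-\langle\mathrm{wt}(x),\alpha_i^\vee\rangle\}$, $\ddot{\varphi}_i(x\ddot{\otimes}x')=\max\{\ddot{\varphi}_i(x)+\langle\mathrm{wt}(x'),\alpha_i^\vee\rangle,\ddot{\varphi}_i(x')\}$.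 This is again a seminormal quasi-crystal. -}

module Defs where

open import Level using (Level; _⊔_) renaming (suc to lsuc)
open import Data.Bool using (Bool; true; false; if_then_else_; _∧_)
open import Data.Nat using (ℕ; zero; suc; _≤_)
open import Data.Integer as ℤ using (ℤ; +_; -_; _≤ᵇ_)
open import Data.Maybe using (Maybe; just; nothing; _>>=_; is-just)
open import Data.Product using (Σ; _×_; _,_; ∃)
open import Data.Sum using (_⊎_)
open import Relation.Binary.PropositionalEquality using (_≡_; _≢_)
open import Algebra.Structures using (IsAbelianGroup)

-- Only what quasi-crystals use of (Φ, (α_i), Λ):
-- the weight lattice Λ as an abelian group (subgroup of V, so equality is
-- propositional), the simple roots α_i ∈ Λ and the ℤ-valued pairings
-- λ ↦ ⟨λ, α_i^∨⟩, which are additive, with ⟨α_i, α_i^∨⟩ = 2.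

record RootDatum : Set₁ where
  field
    I        : Set
    Λ        : Set
    _+Λ_     : Λ → Λ → Λ
    0Λ       : Λ
    -Λ_      : Λ → Λ
    isAbelianGroup : IsAbelianGroup _≡_ _+Λ_ 0Λ -Λ_
    α        : I → Λ
    ⟨_,_∨⟩   : Λ → I → ℤ
    pair-+   : ∀ l m i → ⟨ l +Λ m , i ∨⟩ ≡ ⟨ l , i ∨⟩ ℤ.+ ⟨ m , i ∨⟩
    pair-αα  : ∀ i → ⟨ α i , i ∨⟩ ≡ + 2

data ℤ∞ : Set where
  fin  : ℤ → ℤ∞
  +∞ −∞ : ℤ∞

infixl 20 _⊕_
_⊕_ : ℤ∞ → ℤ → ℤ∞
fin a ⊕ m = fin (a ℤ.+ m)
+∞    ⊕ m = +∞
−∞    ⊕ m = −∞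

_≤∞ᵇ_ : ℤ∞ → ℤ∞ → Bool
−∞    ≤∞ᵇ _     = true
_     ≤∞ᵇ +∞    = true
+∞    ≤∞ᵇ _     = false
fin _ ≤∞ᵇ −∞    = false
fin a ≤∞ᵇ fin b = a ≤ᵇ b

_<∞ᵇ_ : ℤ∞ → ℤ∞ → Bool
x <∞ᵇ y = if y ≤∞ᵇ x then false else true

max∞ : ℤ∞ → ℤ∞ → ℤ∞
max∞ x y = if x ≤∞ᵇ y then y else x

-- Quasi-crystals.  ⊥ (undefined) is modelled by `nothing`.

module _ (D : RootDatum) where
  open RootDatum D

  record QCData (ℓ : Level) : Set (lsuc ℓ) where
    field
      Q   : Set ℓ
      wt  : Q → Λ
      e f : I → Q → Maybe Q
      ε φ : I → Q → ℤ∞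

  iter : ∀ {ℓ} {A : Set ℓ} → (A → Maybe A) → ℕ → A → Maybe A
  iter g zero    x = just x
  iter g (suc k) x = iter g k x >>= g

  IsMaxIter : ∀ {ℓ} {A : Set ℓ} → (A → Maybe A) → A → ℕ → Set
  IsMaxIter g x k = (is-just (iter g k x) ≡ true)
                  × (∀ m → is-just (iter g m x) ≡ true → m ≤ k)

  record IsQuasiCrystal {ℓ} (C : QCData ℓ) : Set ℓ where
    open QCData C
    field
      φ-ε   : ∀ i x → φ i x ≡ ε i x ⊕ ⟨ wt x , i ∨⟩
      e-wt  : ∀ i x y → e i x ≡ just y → wt y ≡ wt x +Λ α i
      e-ε   : ∀ i x y → e i x ≡ just y → ε i y ≡ ε i x ⊕ (ℤ.- + 1)
      e-φ   : ∀ i x y → e i x ≡ just y → φ i y ≡ φ i x ⊕ (+ 1)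
      f-wt  : ∀ i x y → f i x ≡ just y → wt y ≡ wt x +Λ (-Λ α i)
      f-ε   : ∀ i x y → f i x ≡ just y → ε i y ≡ ε i x ⊕ (+ 1)
      f-φ   : ∀ i x y → f i x ≡ just y → φ i y ≡ φ i x ⊕ (ℤ.- + 1)
      e⇒f   : ∀ i x y → e i x ≡ just y → f i y ≡ just x
      f⇒e   : ∀ i x y → f i y ≡ just x → e i x ≡ just y
      ∞-e   : ∀ i x → (ε i x ≡ +∞ ⊎ ε i x ≡ −∞) → e i x ≡ nothing
      ∞-f   : ∀ i x → (ε i x ≡ +∞ ⊎ ε i x ≡ −∞) → f i x ≡ nothing

  record IsSeminormal {ℓ} (C : QCData ℓ) : Set ℓ where
    open QCData C
    field
      isQuasiCrystal : IsQuasiCrystal C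
      seminormal : ∀ i x → ε i x ≢ +∞ →
        (Σ ℕ λ k → ε i x ≡ fin (+ k) × IsMaxIter (e i) x k) ×
        (Σ ℕ λ k → φ i x ≡ fin (+ k) × IsMaxIter (f i) x k)

  record SeminormalQuasiCrystal (ℓ : Level) : Set (lsuc ℓ) where
    field
      qcData       : QCData ℓ
      isSeminormal : IsSeminormal qcData
    open QCData qcData public

  _⊗̈_ : ∀ {ℓ ℓ'} → QCData ℓ → QCData ℓ' → QCData (ℓ ⊔ ℓ')
  C ⊗̈ C' = record
    { Q  = C.Q × C'.Q
    ; wt = λ { (x , x') → C.wt x +Λ C'.wt x' }
    ; e  = λ i → λ { (x , x') →
             if blocked i x x' then nothing
             else (if C'.ε i x' ≤∞ᵇ C.φ i x
                   then (C.e i x >>= λ y → just (y , x'))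
                   else (C'.e i x' >>= λ y' → just (x , y'))) }
    ; f  = λ i → λ { (x , x') →
             if blocked i x x' then nothing
             else (if C'.ε i x' <∞ᵇ C.φ i x
                   then (C.f i x >>= λ y → just (y , x'))
                   else (C'.f i x' >>= λ y' → just (x , y'))) }
    ; ε  = λ i → λ { (x , x') →
             if blocked i x x' then +∞
             else max∞ (C.ε i x) (C'.ε i x' ⊕ (ℤ.- ⟨ C.wt x , i ∨⟩)) }
    ; φ  = λ i → λ { (x , x') →
             if blocked i x x' then +∞
             else max∞ (C.φ i x ⊕ ⟨ C'.wt x' , i ∨⟩) (C'.φ i x') }
    }
    where
      module C  = QCData C
      module C' = QCData C'
      blocked : I → C.Q → C'.Q → Bool
      blocked i x x' = (fin (+ 0) <∞ᵇ C.φ i x) ∧ (fin (+ 0) <∞ᵇ C'.ε i x')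

  record IsHomomorphism {ℓ ℓ'} (C : QCData ℓ) (C' : QCData ℓ')
         (ψ : Maybe (QCData.Q C) → Maybe (QCData.Q C')) : Set (ℓ ⊔ ℓ') where
    module C  = QCData C
    module C' = QCData C'
    field
      ψ-⊥  : ψ nothing ≡ nothing
      ψ-wt : ∀ x y → ψ (just x) ≡ just y → C'.wt y ≡ C.wt x
      ψ-ε  : ∀ i x y → ψ (just x) ≡ just y → C'.ε i y ≡ C.ε i x
      ψ-φ  : ∀ i x y → ψ (just x) ≡ just y → C'.φ i y ≡ C.φ i x
      ψ-e  : ∀ i x x₁ y y₁ → C.e i x ≡ just x₁ → ψ (just x) ≡ just y →
               ψ (just x₁) ≡ just y₁ → C'.e i y ≡ just y₁
      ψ-f  : ∀ i x x₁ y y₁ → C.f i x ≡ just x₁ → ψ (just x) ≡ just y →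
               ψ (just x₁) ≡ just y₁ → C'.f i y ≡ just y₁

  IsIsomorphism : ∀ {ℓ ℓ'} (C : QCData ℓ) (C' : QCData ℓ')
         (ψ : Maybe (QCData.Q C) → Maybe (QCData.Q C')) → Set (ℓ ⊔ ℓ')
  IsIsomorphism C C' ψ =
    Σ (Maybe (QCData.Q C') → Maybe (QCData.Q C)) λ ψ⁻¹ →
      (∀ x → ψ⁻¹ (ψ x) ≡ x) × (∀ y → ψ (ψ⁻¹ y) ≡ y) ×
      IsHomomorphism C C' ψ × IsHomomorphism C' C ψ⁻¹

-- Fix a colour i. In a seminormal quasi-crystal the i-data of an element x is summarised by its
-- signature: either blocked (ε_i = φ_i = +∞, so ë_i and f̈_i are undefined) or a pair (a , b) of
-- naturals with ε_i = a, φ_i = b and ⟨wt x, α_i^∨⟩ = b − a. The quasi-tensor product multiplies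
-- signatures in the monoid with absorbing element in which (a , b) · (a' , b') is blocked when
-- b, a' > 0 and is (a + a' , b + b') otherwise, and ë_i, f̈_i act on the left or the right factor
-- according to a rule that only sees the two signatures. Associativity of this monoid identifies
-- ε_i and φ_i on both bracketings of x₁ ⊗ x₂ ⊗ x₃, and a finite check shows that the two nested
-- rules select the same one of the three factors.
module Submission where

open import Defs
open import Level using (Level; _⊔_)
open import Function using (_∘_)
open import Data.Bool using (Bool; true; false; if_then_else_; _∧_; T)
open import Data.Unit using (tt)
open import Data.Product using (Σ; _×_; _,_; proj₁; proj₂)
open import Data.Product.Base using (assocʳ′; assocˡ′)
open import Data.Sum using (inj₁)
open import Data.Maybe using (Maybe; just; nothing; _>>=_)
open import Data.Maybe as Maybe using ()
open import Data.Maybe.Properties using (map-injective)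
open import Data.Nat as ℕ using (ℕ; zero; suc)
import Data.Nat.Properties as ℕP
open import Data.Integer as ℤ using (ℤ; +_)
import Data.Integer.Properties as ℤP
open import Data.Integer.Solver using (module +-*-Solver)
open import Relation.Binary.PropositionalEquality
open import Relation.Nullary using (Dec; yes; no)
open import Algebra.Structures using (IsAbelianGroup)

-- nothing is the blocked signature, just (ε , φ) a finite one.
Signature : Set
Signature = Maybe (ℕ × ℕ)

blocks : ℕ → ℕ → Bool
blocks (suc _) (suc _) = true
blocks _       _       = false

infixl 7 _∙_
_∙_ : Signature → Signature → Signature
nothing      ∙ _             = nothing
just _       ∙ nothing       = nothing
just (a , b) ∙ just (a' , b') =
  if blocks b a' then nothing else just (a ℕ.+ a' , b ℕ.+ b')

∙-nothingʳ : ∀ s → s ∙ nothing ≡ nothing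
∙-nothingʳ nothing  = refl
∙-nothingʳ (just _) = refl

just-+-assoc : ∀ a₁ b₁ a₂ b₂ a₃ b₃ →
  just ((a₁ ℕ.+ a₂) ℕ.+ a₃ , (b₁ ℕ.+ b₂) ℕ.+ b₃) ≡ just (a₁ ℕ.+ (a₂ ℕ.+ a₃) , b₁ ℕ.+ (b₂ ℕ.+ b₃))
just-+-assoc a₁ b₁ a₂ b₂ a₃ b₃ =
  cong₂ (λ a b → just (a , b)) (ℕP.+-assoc a₁ a₂ a₃) (ℕP.+-assoc b₁ b₂ b₃)

∙-assoc : ∀ s₁ s₂ s₃ → (s₁ ∙ s₂) ∙ s₃ ≡ s₁ ∙ (s₂ ∙ s₃)
∙-assoc nothing  _        _       = refl
∙-assoc (just _) nothing  _       = refl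
∙-assoc (just p) (just q) nothing = ∙-nothingʳ (just p ∙ just q)
∙-assoc (just (a₁ , zero)) (just (zero , zero)) (just (a₃ , b₃)) = just-+-assoc a₁ 0 0 0 a₃ b₃
∙-assoc (just (a₁ , zero)) (just (zero , suc b₂)) (just (zero , b₃)) = just-+-assoc a₁ 0 0 (suc b₂) 0 b₃
∙-assoc (just (_ , zero)) (just (zero , suc _)) (just (suc _ , _)) = refl
∙-assoc (just (a₁ , zero)) (just (suc a₂ , zero)) (just (a₃ , b₃)) = just-+-assoc a₁ 0 (suc a₂) 0 a₃ b₃
∙-assoc (just (a₁ , zero)) (just (suc a₂ , suc b₂)) (just (zero , b₃)) = just-+-assoc a₁ 0 (suc a₂) (suc b₂) 0 b₃
∙-assoc (just (_ , zero)) (just (suc _ , suc _)) (just (suc _ , _)) = refl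
∙-assoc (just (a₁ , suc b₁)) (just (zero , zero)) (just (zero , b₃)) = just-+-assoc a₁ (suc b₁) 0 0 0 b₃
∙-assoc (just (a₁ , suc b₁)) (just (zero , suc b₂)) (just (zero , b₃)) = just-+-assoc a₁ (suc b₁) 0 (suc b₂) 0 b₃
∙-assoc (just (_ , suc _)) (just (zero , zero)) (just (suc _ , _)) = refl
∙-assoc (just (_ , suc _)) (just (zero , suc _)) (just (suc _ , _)) = refl
∙-assoc (just (_ , suc _)) (just (suc _ , zero)) (just _) = refl
∙-assoc (just (_ , suc _)) (just (suc _ , suc _)) (just (zero , _)) = refl
∙-assoc (just (_ , suc _)) (just (suc _ , suc _)) (just (suc _ , _)) = refl

data Side : Set where
  none left right : Side

data Side₃ : Set where
  none first second third : Side₃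

select : ∀ {a} {A : Set a} → Side → Maybe A → Maybe A → Maybe A
select none  _ _ = nothing
select left  l _ = l
select right _ r = r

select₃ : ∀ {a} {A : Set a} → Side₃ → Maybe A → Maybe A → Maybe A → Maybe A
select₃ none   _ _ _ = nothing
select₃ first  m _ _ = m
select₃ second _ m _ = m
select₃ third  _ _ m = m

-- nestˡ o o' is the factor of (x₁ ⊗ x₂) ⊗ x₃ reached by the outer choice o followed by the inner
-- choice o'; nestʳ likewise for x₁ ⊗ (x₂ ⊗ x₃).
nestˡ : Side → Side → Side₃
nestˡ none  _     = none
nestˡ left  none  = none
nestˡ left  left  = first
nestˡ left  right = second
nestˡ right _     = third

nestʳ : Side → Side → Side₃
nestʳ none  _     = none
nestʳ left  _     = first
nestʳ right none  = none
nestʳ right left  = second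
nestʳ right right = third

module _ {a b c} {A : Set a} {B : Set b} {C : Set c} where

  >>=-just-∘ : ∀ {f : A → B} {g : B → C} m →
               ((m >>= λ y → just (f y)) >>= λ z → just (g z)) ≡ (m >>= λ y → just (g (f y)))
  >>=-just-∘ nothing  = refl
  >>=-just-∘ (just _) = refl

  map->>=-just : ∀ {f : A → B} {g : B → C} m →
                 Maybe.map g (m >>= λ y → just (f y)) ≡ (m >>= λ y → just (g (f y)))
  map->>=-just nothing  = refl
  map->>=-just (just _) = refl

module _ {a b} {A : Set a} {B : Set b} where

  map-inverse : ∀ {f : A → B} {g : B → A} → (∀ x → g (f x) ≡ x) →
                ∀ m → Maybe.map g (Maybe.map f m) ≡ m
  map-inverse _       nothing  = refl
  map-inverse inverse (just x) = cong just (inverse x)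

  select-nestʳ : ∀ o o' (l : Maybe A) {m r : Maybe B} {g : B → Maybe A} {m' r'} →
                 (m >>= g) ≡ m' → (r >>= g) ≡ r' →
                 select o l (select o' m r >>= g) ≡ select₃ (nestʳ o o') l m' r'
  select-nestʳ none  _     _ _  _  = refl
  select-nestʳ left  _     _ _  _  = refl
  select-nestʳ right none  _ _  _  = refl
  select-nestʳ right left  _ m≡ _  = m≡
  select-nestʳ right right _ _  r≡ = r≡

  select-nestˡ : ∀ o o' {l m : Maybe B} (r : Maybe A) {g : B → Maybe A} {l' m'} →
                 (l >>= g) ≡ l' → (m >>= g) ≡ m' →
                 select o (select o' l m >>= g) r ≡ select₃ (nestˡ o o') l' m' r
  select-nestˡ none  _     _ _  _  = refl
  select-nestˡ left  none  _ _  _  = refl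
  select-nestˡ left  left  _ l≡ _  = l≡
  select-nestˡ left  right _ _  m≡ = m≡
  select-nestˡ right _     _ _  _  = refl

  map-select₃ : ∀ (h : A → B) t {l m r l' m' r'} →
                Maybe.map h l ≡ l' → Maybe.map h m ≡ m' → Maybe.map h r ≡ r' →
                Maybe.map h (select₃ t l m r) ≡ select₃ t l' m' r'
  map-select₃ _ none   _  _  _  = refl
  map-select₃ _ first  l≡ _  _  = l≡
  map-select₃ _ second _  m≡ _  = m≡
  map-select₃ _ third  _  _  r≡ = r≡

data Direction : Set where
  raising lowering : Direction

sideℕ : Direction → ℕ → ℕ → Side
sideℕ _        (suc _) (suc _) = none
sideℕ raising  _       zero    = left
sideℕ raising  zero    (suc _) = right
sideℕ lowering zero    _       = right
sideℕ lowering (suc _) zero    = left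

side : Direction → Signature → Signature → Side
side d (just (_ , φ)) (just (ε' , _)) = sideℕ d φ ε'
side _ _              _               = none

side-undefined : ∀ d s s' → s ∙ s' ≡ nothing → side d s s' ≡ none
side-undefined _ nothing            _                  _ = refl
side-undefined _ (just _)           nothing            _ = refl
side-undefined _ (just (_ , suc _)) (just (suc _ , _)) _ = refl
side-undefined _ (just (_ , zero))  (just _)           ()
side-undefined _ (just (_ , suc _)) (just (zero , _))  ()

side-nothingʳ : ∀ d s → side d s nothing ≡ none
side-nothingʳ _ nothing  = refl
side-nothingʳ _ (just _) = refl

-- Only whether φ(x₁), ε(x₂), φ(x₂) and ε(x₃) vanish matters.
side-assoc : ∀ d s₁ s₂ s₃ →
  nestˡ (side d (s₁ ∙ s₂) s₃) (side d s₁ s₂) ≡ nestʳ (side d s₁ (s₂ ∙ s₃)) (side d s₂ s₃)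
side-assoc _ nothing  _        _ = refl
side-assoc _ (just _) nothing  _ = refl
side-assoc d (just p) (just q) nothing rewrite side-nothingʳ d (just p ∙ just q) = refl
side-assoc raising  (just (_ , zero )) (just (zero  , zero )) (just (zero  , _)) = refl
side-assoc raising  (just (_ , zero )) (just (zero  , zero )) (just (suc _ , _)) = refl
side-assoc raising  (just (_ , zero )) (just (zero  , suc _)) (just (zero  , _)) = refl
side-assoc raising  (just (_ , zero )) (just (zero  , suc _)) (just (suc _ , _)) = refl
side-assoc raising  (just (_ , zero )) (just (suc _ , zero )) (just (zero  , _)) = refl
side-assoc raising  (just (_ , zero )) (just (suc _ , zero )) (just (suc _ , _)) = refl
side-assoc raising  (just (_ , zero )) (just (suc _ , suc _)) (just (zero  , _)) = refl
side-assoc raising  (just (_ , zero )) (just (suc _ , suc _)) (just (suc _ , _)) = refl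
side-assoc raising  (just (_ , suc _)) (just (zero  , zero )) (just (zero  , _)) = refl
side-assoc raising  (just (_ , suc _)) (just (zero  , zero )) (just (suc _ , _)) = refl
side-assoc raising  (just (_ , suc _)) (just (zero  , suc _)) (just (zero  , _)) = refl
side-assoc raising  (just (_ , suc _)) (just (zero  , suc _)) (just (suc _ , _)) = refl
side-assoc raising  (just (_ , suc _)) (just (suc _ , zero )) (just (zero  , _)) = refl
side-assoc raising  (just (_ , suc _)) (just (suc _ , zero )) (just (suc _ , _)) = refl
side-assoc raising  (just (_ , suc _)) (just (suc _ , suc _)) (just (zero  , _)) = refl
side-assoc raising  (just (_ , suc _)) (just (suc _ , suc _)) (just (suc _ , _)) = refl
side-assoc lowering (just (_ , zero )) (just (zero  , zero )) (just (zero  , _)) = refl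
side-assoc lowering (just (_ , zero )) (just (zero  , zero )) (just (suc _ , _)) = refl
side-assoc lowering (just (_ , zero )) (just (zero  , suc _)) (just (zero  , _)) = refl
side-assoc lowering (just (_ , zero )) (just (zero  , suc _)) (just (suc _ , _)) = refl
side-assoc lowering (just (_ , zero )) (just (suc _ , zero )) (just (zero  , _)) = refl
side-assoc lowering (just (_ , zero )) (just (suc _ , zero )) (just (suc _ , _)) = refl
side-assoc lowering (just (_ , zero )) (just (suc _ , suc _)) (just (zero  , _)) = refl
side-assoc lowering (just (_ , zero )) (just (suc _ , suc _)) (just (suc _ , _)) = refl
side-assoc lowering (just (_ , suc _)) (just (zero  , zero )) (just (zero  , _)) = refl
side-assoc lowering (just (_ , suc _)) (just (zero  , zero )) (just (suc _ , _)) = refl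
side-assoc lowering (just (_ , suc _)) (just (zero  , suc _)) (just (zero  , _)) = refl
side-assoc lowering (just (_ , suc _)) (just (zero  , suc _)) (just (suc _ , _)) = refl
side-assoc lowering (just (_ , suc _)) (just (suc _ , zero )) (just (zero  , _)) = refl
side-assoc lowering (just (_ , suc _)) (just (suc _ , zero )) (just (suc _ , _)) = refl
side-assoc lowering (just (_ , suc _)) (just (suc _ , suc _)) (just (zero  , _)) = refl
side-assoc lowering (just (_ , suc _)) (just (suc _ , suc _)) (just (suc _ , _)) = refl

data SignatureValues : Signature → ℤ∞ → ℤ∞ → ℤ → Set where
  blocked : ∀ {w} → SignatureValues nothing +∞ +∞ w
  finite  : ∀ {w} a b → w ≡ + b ℤ.- + a → SignatureValues (just (a , b)) (fin (+ a)) (fin (+ b)) w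

blocked-values : ∀ {ε φ w} → ε ≡ +∞ → φ ≡ +∞ → SignatureValues nothing ε φ w
blocked-values refl refl = blocked

finite-values : ∀ {ε φ w} a b → ε ≡ fin (+ a) → φ ≡ fin (+ b) → w ≡ + b ℤ.- + a →
                SignatureValues (just (a , b)) ε φ w
finite-values a b refl refl w≡ = finite a b w≡

values-unique : ∀ {s s' ε φ ε' φ' w w'} → s ≡ s' →
                SignatureValues s ε φ w → SignatureValues s' ε' φ' w' → ε ≡ ε' × φ ≡ φ'
values-unique refl blocked        blocked          = refl , refl
values-unique refl (finite a b _) (finite .a .b _) = refl , refl

-- The clauses of _⊗̈_, written in terms of (ε, φ, ⟨wt, α_i^∨⟩) of the two factors.
tensorBlocked : ℤ∞ → ℤ∞ → Bool
tensorBlocked φ ε' = (fin (+ 0) <∞ᵇ φ) ∧ (fin (+ 0) <∞ᵇ ε')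

tensorε : ℤ∞ → ℤ∞ → ℤ∞ → ℤ → ℤ∞
tensorε ε φ ε' w = if tensorBlocked φ ε' then +∞ else max∞ ε (ε' ⊕ (ℤ.- w))

tensorφ : ℤ∞ → ℤ∞ → ℤ∞ → ℤ → ℤ∞
tensorφ φ ε' φ' w' = if tensorBlocked φ ε' then +∞ else max∞ (φ ⊕ w') φ'

tensorE tensorF : ∀ {a} {A : Set a} → ℤ∞ → ℤ∞ → Maybe A → Maybe A → Maybe A
tensorE φ ε' l r = if tensorBlocked φ ε' then nothing else (if ε' ≤∞ᵇ φ then l else r)
tensorF φ ε' l r = if tensorBlocked φ ε' then nothing else (if ε' <∞ᵇ φ then l else r)

max∞-fin-≤ : ∀ {m n} → m ℤ.≤ n → max∞ (fin m) (fin n) ≡ fin n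
max∞-fin-≤ {m} {n} m≤n with m ℤ.≤ᵇ n | ℤP.≤⇒≤ᵇ m≤n
... | true | _ = refl

max∞-fin-≥ : ∀ {m n} → n ℤ.≤ m → max∞ (fin m) (fin n) ≡ fin m
max∞-fin-≥ {m} {n} n≤m with m ℤ.≤ᵇ n in m≤ᵇn
... | true  = cong fin (ℤP.≤-antisym n≤m (ℤP.≤ᵇ⇒≤ (subst T (sym m≤ᵇn) tt)))
... | false = refl

fin-injective : ∀ {m n} → fin m ≡ fin n → m ≡ n
fin-injective refl = refl

_≟+∞ : (v : ℤ∞) → Dec (v ≡ +∞)
fin _ ≟+∞ = no λ ()
+∞    ≟+∞ = yes refl
−∞    ≟+∞ = no λ ()

open +-*-Solver

pairing-from-φ-ε : ∀ {a b w} → fin (+ b) ≡ fin (+ a ℤ.+ w) → w ≡ + b ℤ.- + a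
pairing-from-φ-ε {a} {w = w} φ≡ε+w =
  subst (λ v → w ≡ v ℤ.- + a) (sym (fin-injective φ≡ε+w))
        (solve 2 (λ A W → W := (A :+ W) :- A) refl (+ a) w)

minus-+-minus : ∀ a b a' b' → (+ b ℤ.- + a) ℤ.+ (+ b' ℤ.- + a') ≡ + (b ℕ.+ b') ℤ.- + (a ℕ.+ a')
minus-+-minus a b a' b' rewrite ℤP.pos-+ b b' | ℤP.pos-+ a a' =
  solve 4 (λ A B A' B' → (B :- A) :+ (B' :- A') := (B :+ B') :- (A :+ A')) refl (+ a) (+ b) (+ a') (+ b')

∙-values : ∀ {s s' ε φ ε' φ' w w'} →
  SignatureValues s ε φ w → SignatureValues s' ε' φ' w' →
  SignatureValues (s ∙ s') (tensorε ε φ ε' w) (tensorφ φ ε' φ' w') (w ℤ.+ w')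
∙-values blocked            blocked                = blocked
∙-values blocked            (finite zero b' _)     = blocked
∙-values blocked            (finite (suc a') b' _) = blocked
∙-values (finite a zero _)    blocked                = blocked
∙-values (finite a (suc b) _) blocked                = blocked
∙-values (finite a (suc b) _) (finite (suc a') b' _) = blocked
∙-values {w = w} {w'} (finite a zero w≡) (finite a' b' w'≡) =
  finite-values (a ℕ.+ a') b' ε≡ φ≡ (trans (cong₂ ℤ._+_ w≡ w'≡) (minus-+-minus a 0 a' b'))
  where
  shift : + a' ℤ.+ ℤ.- w ≡ + (a ℕ.+ a')
  shift rewrite w≡ | ℤP.pos-+ a a' =
    solve 2 (λ A A' → A' :+ :- (con (+ 0) :- A) := A :+ A') refl (+ a) (+ a')
  ε≡ : max∞ (fin (+ a)) (fin (+ a' ℤ.+ ℤ.- w)) ≡ fin (+ (a ℕ.+ a'))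
  ε≡ = trans (cong (max∞ (fin (+ a)) ∘ fin) shift) (max∞-fin-≤ (ℤ.+≤+ (ℕP.m≤m+n a a')))
  φ≡ : max∞ (fin (+ 0 ℤ.+ w')) (fin (+ b')) ≡ fin (+ b')
  φ≡ rewrite ℤP.+-identityˡ w' | w'≡ = max∞-fin-≤ (ℤP.i-j≤i (+ b') (+ a'))
∙-values {w = w} {w'} (finite a (suc b) w≡) (finite zero b' w'≡) =
  finite-values (a ℕ.+ 0) (suc b ℕ.+ b') ε≡ φ≡
    (trans (cong₂ ℤ._+_ w≡ w'≡) (minus-+-minus a (suc b) 0 b'))
  where
  shift : + 0 ℤ.+ ℤ.- w ≡ + a ℤ.- + suc b
  shift rewrite w≡ = solve 2 (λ A B → con (+ 0) :+ :- (B :- A) := A :- B) refl (+ a) (+ suc b)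
  ε≡ : max∞ (fin (+ a)) (fin (+ 0 ℤ.+ ℤ.- w)) ≡ fin (+ (a ℕ.+ 0))
  ε≡ rewrite ℕP.+-identityʳ a =
    trans (cong (max∞ (fin (+ a)) ∘ fin) shift) (max∞-fin-≥ (ℤP.i-j≤i (+ a) (+ suc b)))
  φ≡ : max∞ (fin (+ suc b ℤ.+ w')) (fin (+ b')) ≡ fin (+ (suc b ℕ.+ b'))
  φ≡ rewrite w'≡ | ℕP.+-identityʳ b' | ℤP.pos-+ (suc b) b' = max∞-fin-≥ (ℤP.i≤j+i (+ b') (+ suc b))

tensorOp : Direction → ∀ {a} {A : Set a} → ℤ∞ → ℤ∞ → Maybe A → Maybe A → Maybe A
tensorOp raising  = tensorE
tensorOp lowering = tensorF

tensor-select : ∀ d {a} {A : Set a} {s s' ε φ ε' φ' w w'} (l r : Maybe A) →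
  SignatureValues s ε φ w → SignatureValues s' ε' φ' w' →
  (s ≡ nothing → l ≡ nothing) → (s' ≡ nothing → r ≡ nothing) →
  tensorOp d φ ε' l r ≡ select (side d s s') l r
tensor-select raising  _ _ blocked              blocked              _           _           = refl
tensor-select raising  _ _ blocked              (finite zero _ _)    l-undefined _           = l-undefined refl
tensor-select raising  _ _ blocked              (finite (suc _) _ _) _           _           = refl
tensor-select raising  _ _ (finite _ zero _)    blocked              _           r-undefined = r-undefined refl
tensor-select raising  _ _ (finite _ (suc _) _) blocked              _           _           = refl
tensor-select raising  _ _ (finite _ zero _)    (finite zero _ _)    _           _           = refl
tensor-select raising  _ _ (finite _ zero _)    (finite (suc _) _ _) _           _           = refl
tensor-select raising  _ _ (finite _ (suc _) _) (finite zero _ _)    _           _           = refl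
tensor-select raising  _ _ (finite _ (suc _) _) (finite (suc _) _ _) _           _           = refl
tensor-select lowering _ _ blocked              blocked              _           _           = refl
tensor-select lowering _ _ blocked              (finite zero _ _)    l-undefined _           = l-undefined refl
tensor-select lowering _ _ blocked              (finite (suc _) _ _) _           _           = refl
tensor-select lowering _ _ (finite _ zero _)    blocked              _           r-undefined = r-undefined refl
tensor-select lowering _ _ (finite _ (suc _) _) blocked              _           _           = refl
tensor-select lowering _ _ (finite _ zero _)    (finite zero _ _)    _           _           = refl
tensor-select lowering _ _ (finite _ zero _)    (finite (suc _) _ _) _           _           = refl
tensor-select lowering _ _ (finite _ (suc _) _) (finite zero _ _)    _           _           = refl
tensor-select lowering _ _ (finite _ (suc _) _) (finite (suc _) _ _) _           _           = refl

module _ (D : RootDatum) where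
  open RootDatum D

  infixl 6 _⊗_
  _⊗_ : ∀ {ℓ ℓ'} → QCData D ℓ → QCData D ℓ' → QCData D (ℓ ⊔ ℓ')
  _⊗_ = _⊗̈_ D

  operator : Direction → ∀ {ℓ} (C : QCData D ℓ) → I → QCData.Q C → Maybe (QCData.Q C)
  operator raising  = QCData.e
  operator lowering = QCData.f

  record HasSignature {ℓ} (C : QCData D ℓ) (i : I) (x : QCData.Q C) (s : Signature) : Set ℓ where
    field
      values    : SignatureValues s (QCData.ε C i x) (QCData.φ C i x) ⟨ QCData.wt C x , i ∨⟩
      undefined : ∀ d → s ≡ nothing → operator d C i x ≡ nothing
  open HasSignature

  Signed : ∀ {ℓ} → QCData D ℓ → Set ℓ
  Signed C = ∀ i x → Σ Signature (HasSignature C i x)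

  module _ {ℓ} (𝒬 : SeminormalQuasiCrystal D ℓ) where
    open SeminormalQuasiCrystal 𝒬
    open IsSeminormal isSeminormal
    open IsQuasiCrystal isQuasiCrystal

    seminormal⇒signed : Signed qcData
    seminormal⇒signed i x with ε i x ≟+∞
    ... | yes ε≡+∞ = nothing , record
      { values    = blocked-values ε≡+∞ (trans (φ-ε i x) (cong (_⊕ _) ε≡+∞))
      ; undefined = λ { raising _ → ∞-e i x (inj₁ ε≡+∞) ; lowering _ → ∞-f i x (inj₁ ε≡+∞) }
      }
    ... | no ε≢+∞ with seminormal i x ε≢+∞
    ... | (a , ε≡a , _) , (b , φ≡b , _) = just (a , b) , record
      { values    = finite-values a b ε≡a φ≡b
                      (pairing-from-φ-ε (trans (sym φ≡b) (trans (φ-ε i x) (cong (_⊕ _) ε≡a))))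
      ; undefined = λ _ ()
      }

  module _ {ℓ ℓ'} {C : QCData D ℓ} {C' : QCData D ℓ'} {i x x' s s'}
           (h : HasSignature C i x s) (h' : HasSignature C' i x' s') where

    operator-⊗ : ∀ d → operator d (C ⊗ C') i (x , x') ≡
                 select (side d s s') (operator d C i x >>= λ y → just (y , x'))
                                      (operator d C' i x' >>= λ y' → just (x , y'))
    operator-⊗ d = trans (by-formula d) (tensor-select d _ _ (values h) (values h')
                     (λ s≡ → cong (_>>= _) (undefined h d s≡))
                     (λ s'≡ → cong (_>>= _) (undefined h' d s'≡)))
      where
      by-formula : ∀ d → operator d (C ⊗ C') i (x , x') ≡
                   tensorOp d (QCData.φ C i x) (QCData.ε C' i x')
                              (operator d C i x >>= λ y → just (y , x'))
                              (operator d C' i x' >>= λ y' → just (x , y'))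
      by-formula raising  = refl
      by-formula lowering = refl

    ⊗-signature : HasSignature (C ⊗ C') i (x , x') (s ∙ s')
    ⊗-signature = record
      { values    = subst (SignatureValues (s ∙ s') _ _) (sym (pair-+ (QCData.wt C x) (QCData.wt C' x') i))
                          (∙-values (values h) (values h'))
      ; undefined = λ d s∙s'≡ →
          trans (operator-⊗ d) (cong (λ o → select o _ _) (side-undefined d s s' s∙s'≡))
      }

  module Reassociation {ℓ₁ ℓ₂ ℓ₃} {C₁ : QCData D ℓ₁} {C₂ : QCData D ℓ₂} {C₃ : QCData D ℓ₃}
           {i x₁ x₂ x₃ s₁ s₂ s₃} (h₁ : HasSignature C₁ i x₁ s₁) (h₂ : HasSignature C₂ i x₂ s₂)
           (h₃ : HasSignature C₃ i x₃ s₃) where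

    private
      Cˡ = (C₁ ⊗ C₂) ⊗ C₃
      Cʳ = C₁ ⊗ (C₂ ⊗ C₃)
      xˡ = (x₁ , x₂) , x₃
      xʳ = x₁ , (x₂ , x₃)

    ε-φ-assoc : QCData.ε Cʳ i xʳ ≡ QCData.ε Cˡ i xˡ × QCData.φ Cʳ i xʳ ≡ QCData.φ Cˡ i xˡ
    ε-φ-assoc = values-unique (sym (∙-assoc s₁ s₂ s₃)) (values (⊗-signature h₁ (⊗-signature h₂ h₃)))
                                                       (values (⊗-signature (⊗-signature h₁ h₂) h₃))

    module _ (d : Direction) where
      private
        outerˡ = side d (s₁ ∙ s₂) s₃
        innerˡ = side d s₁ s₂
        outerʳ = side d s₁ (s₂ ∙ s₃)
        innerʳ = side d s₂ s₃
        move₁ = operator d C₁ i x₁ >>= λ y → just (y , (x₂ , x₃))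
        move₂ = operator d C₂ i x₂ >>= λ y → just (x₁ , (y , x₃))
        move₃ = operator d C₃ i x₃ >>= λ y → just (x₁ , (x₂ , y))
        moveˡ₁ = operator d C₁ i x₁ >>= λ y → just ((y , x₂) , x₃)
        moveˡ₂ = operator d C₂ i x₂ >>= λ y → just ((x₁ , y) , x₃)
        moveˡ₃ = operator d C₃ i x₃ >>= λ y → just ((x₁ , x₂) , y)

      operator-right-nested : operator d Cʳ i xʳ ≡ select₃ (nestʳ outerʳ innerʳ) move₁ move₂ move₃
      operator-right-nested = begin
        operator d Cʳ i xʳ
          ≡⟨ operator-⊗ h₁ (⊗-signature h₂ h₃) d ⟩
        select outerʳ move₁ (operator d (C₂ ⊗ C₃) i (x₂ , x₃) >>= λ y → just (x₁ , y))
          ≡⟨ cong (λ m → select outerʳ move₁ (m >>= λ y → just (x₁ , y))) (operator-⊗ h₂ h₃ d) ⟩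
        select outerʳ move₁ (select innerʳ _ _ >>= λ y → just (x₁ , y))
          ≡⟨ select-nestʳ outerʳ innerʳ move₁
               (>>=-just-∘ (operator d C₂ i x₂)) (>>=-just-∘ (operator d C₃ i x₃)) ⟩
        select₃ (nestʳ outerʳ innerʳ) move₁ move₂ move₃ ∎
        where open ≡-Reasoning

      operator-left-nested : operator d Cˡ i xˡ ≡ select₃ (nestˡ outerˡ innerˡ) moveˡ₁ moveˡ₂ moveˡ₃
      operator-left-nested = begin
        operator d Cˡ i xˡ
          ≡⟨ operator-⊗ (⊗-signature h₁ h₂) h₃ d ⟩
        select outerˡ (operator d (C₁ ⊗ C₂) i (x₁ , x₂) >>= λ y → just (y , x₃)) moveˡ₃
          ≡⟨ cong (λ m → select outerˡ (m >>= λ y → just (y , x₃)) moveˡ₃) (operator-⊗ h₁ h₂ d) ⟩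
        select outerˡ (select innerˡ _ _ >>= λ y → just (y , x₃)) moveˡ₃
          ≡⟨ select-nestˡ outerˡ innerˡ moveˡ₃
               (>>=-just-∘ (operator d C₁ i x₁)) (>>=-just-∘ (operator d C₂ i x₂)) ⟩
        select₃ (nestˡ outerˡ innerˡ) moveˡ₁ moveˡ₂ moveˡ₃ ∎
        where open ≡-Reasoning

      operator-assoc : operator d Cʳ i xʳ ≡ Maybe.map assocʳ′ (operator d Cˡ i xˡ)
      operator-assoc = begin
        operator d Cʳ i xʳ
          ≡⟨ operator-right-nested ⟩
        select₃ (nestʳ outerʳ innerʳ) move₁ move₂ move₃
          ≡⟨ cong (λ t → select₃ t move₁ move₂ move₃) (sym (side-assoc d s₁ s₂ s₃)) ⟩
        select₃ (nestˡ outerˡ innerˡ) move₁ move₂ move₃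
          ≡⟨ sym (map-select₃ assocʳ′ (nestˡ outerˡ innerˡ) (map->>=-just (operator d C₁ i x₁))
                   (map->>=-just (operator d C₂ i x₂)) (map->>=-just (operator d C₃ i x₃))) ⟩
        Maybe.map assocʳ′ (select₃ (nestˡ outerˡ innerˡ) moveˡ₁ moveˡ₂ moveˡ₃)
          ≡⟨ cong (Maybe.map assocʳ′) (sym operator-left-nested) ⟩
        Maybe.map assocʳ′ (operator d Cˡ i xˡ) ∎
        where open ≡-Reasoning

  ⊗-assoc-isomorphism : ∀ {ℓ₁ ℓ₂ ℓ₃} {C₁ : QCData D ℓ₁} {C₂ : QCData D ℓ₂} {C₃ : QCData D ℓ₃} →
    Signed C₁ → Signed C₂ → Signed C₃ →
    IsIsomorphism D ((C₁ ⊗ C₂) ⊗ C₃) (C₁ ⊗ (C₂ ⊗ C₃)) (Maybe.map assocʳ′)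
  ⊗-assoc-isomorphism {C₁ = C₁} {C₂} {C₃} signed₁ signed₂ signed₃ =
    Maybe.map assocˡ′ , map-inverse (λ _ → refl) , map-inverse (λ _ → refl) , forward , backward
    where
    module At (i : I) (x₁ : QCData.Q C₁) (x₂ : QCData.Q C₂) (x₃ : QCData.Q C₃) =
      Reassociation (proj₂ (signed₁ i x₁)) (proj₂ (signed₂ i x₂)) (proj₂ (signed₃ i x₃))
    open IsAbelianGroup isAbelianGroup using (assoc)

    forward : IsHomomorphism D ((C₁ ⊗ C₂) ⊗ C₃) (C₁ ⊗ (C₂ ⊗ C₃)) (Maybe.map assocʳ′)
    forward = record
      { ψ-⊥  = refl
      ; ψ-wt = λ { ((x₁ , x₂) , x₃) _ refl → sym (assoc _ _ _) }
      ; ψ-ε  = λ { i ((x₁ , x₂) , x₃) _ refl → proj₁ (At.ε-φ-assoc i x₁ x₂ x₃) }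
      ; ψ-φ  = λ { i ((x₁ , x₂) , x₃) _ refl → proj₂ (At.ε-φ-assoc i x₁ x₂ x₃) }
      ; ψ-e  = λ { i ((x₁ , x₂) , x₃) _ _ _ e≡ refl refl →
                   trans (At.operator-assoc i x₁ x₂ x₃ raising) (cong (Maybe.map assocʳ′) e≡) }
      ; ψ-f  = λ { i ((x₁ , x₂) , x₃) _ _ _ f≡ refl refl →
                   trans (At.operator-assoc i x₁ x₂ x₃ lowering) (cong (Maybe.map assocʳ′) f≡) }
      }

    backward : IsHomomorphism D (C₁ ⊗ (C₂ ⊗ C₃)) ((C₁ ⊗ C₂) ⊗ C₃) (Maybe.map assocˡ′)
    backward = record
      { ψ-⊥  = refl
      ; ψ-wt = λ { (x₁ , (x₂ , x₃)) _ refl → assoc _ _ _ }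
      ; ψ-ε  = λ { i (x₁ , (x₂ , x₃)) _ refl → sym (proj₁ (At.ε-φ-assoc i x₁ x₂ x₃)) }
      ; ψ-φ  = λ { i (x₁ , (x₂ , x₃)) _ refl → sym (proj₂ (At.ε-φ-assoc i x₁ x₂ x₃)) }
      ; ψ-e  = λ { i (x₁ , (x₂ , x₃)) _ _ _ e≡ refl refl →
                   map-injective (cong assocˡ′) (trans (sym (At.operator-assoc i x₁ x₂ x₃ raising)) e≡) }
      ; ψ-f  = λ { i (x₁ , (x₂ , x₃)) _ _ _ f≡ refl refl →
                   map-injective (cong assocˡ′) (trans (sym (At.operator-assoc i x₁ x₂ x₃ lowering)) f≡) }
      }

theorem5p6 : (D : RootDatum) {ℓ₁ ℓ₂ ℓ₃ : Level}
    (𝒬₁ : SeminormalQuasiCrystal D ℓ₁) (𝒬₂ : SeminormalQuasiCrystal D ℓ₂)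
    (𝒬₃ : SeminormalQuasiCrystal D ℓ₃) →
    let C₁ = SeminormalQuasiCrystal.qcData 𝒬₁
        C₂ = SeminormalQuasiCrystal.qcData 𝒬₂
        C₃ = SeminormalQuasiCrystal.qcData 𝒬₃
    in IsIsomorphism D (_⊗̈_ D (_⊗̈_ D C₁ C₂) C₃) (_⊗̈_ D C₁ (_⊗̈_ D C₂ C₃))
         (Maybe.map λ { ((x₁ , x₂) , x₃) → (x₁ , (x₂ , x₃)) })
theorem5p6 D 𝒬₁ 𝒬₂ 𝒬₃ =
  ⊗-assoc-isomorphism D (seminormal⇒signed D 𝒬₁) (seminormal⇒signed D 𝒬₂) (seminormal⇒signed D 𝒬₃)
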